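{- If $v$ and $w$ are adjacent vertices of degree $2$ in a graph $G$ with at least $5$ vertices, then both $v$ and $w$ are essential in $G$.
   Context: Graphs are finite and simple. $G*v$ is the graph on $V(G)$ with $E(G*v)=E(G)\triangle\{xy:x,y\text{ distinct neighbors of }v\}$. $G\wedge vw:=G*v*w*v$ for an edge $vw$; $G/v$ is $G\setminus v$ if $v$ is isolated and otherwise $G\wedge vw\setminus v$ for any neighbor $w$ of $v$ (well defined up to local equivalence, so its primality is independent of $w$). A split is a partition $(A,B)$ of the vertex set with $\min\{|A|,|B|\}\ge2$ such that for some $A'\subseteq A,B'\subseteq B$, $x\in A,y\in B$ are adjacent iff $x\in A',y\in B'$; prime means no split. A vertex $v$ is non-essential if at least two of $G\setminus v$, $G*v\setminus v$, $G/v$ are prime, and essential otherwise. -}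

module Defs where

open import Data.Nat using (ℕ; zero; suc)
open import Data.Fin using (Fin; punchIn; _≟_)
open import Data.Fin.Properties using (any?)
open import Data.Bool using (Bool; true; false; _∧_; _xor_; T; T?)
open import Data.Bool.Properties using (∧-comm; xor-comm)
open import Data.List using (length; filterᵇ; allFin)
open import Data.Product using (Σ; ∃; _×_; _,_)
open import Data.Sum using (_⊎_)
open import Data.Empty using (⊥-elim)
open import Relation.Nullary using (¬_; Dec; yes; no)
open import Relation.Binary.PropositionalEquality
  using (_≡_; _≢_; refl; sym; trans; cong; cong₂)

record Graph (n : ℕ) : Set where
  field
    adj    : Fin n → Fin n → Bool
    adj-sym    : ∀ x y → adj x y ≡ adj y x
    adj-irrefl : ∀ x → adj x x ≡ false
open Graph public

lcAdj : ∀ {n} → Graph n → Fin n → Fin n → Fin n → Bool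
lcAdj G v x y with x ≟ y
... | yes _ = adj G x y
... | no  _ = adj G x y xor (adj G v x ∧ adj G v y)

private
  lcAdj-sym : ∀ {n} (G : Graph n) v x y → lcAdj G v x y ≡ lcAdj G v y x
  lcAdj-sym G v x y with x ≟ y | y ≟ x
  ... | yes _ | yes _ = adj-sym G x y
  ... | yes p | no ¬q = ⊥-elim (¬q (sym p))
  ... | no ¬p | yes q = ⊥-elim (¬p (sym q))
  ... | no _  | no _  =
    cong₂ _xor_ (adj-sym G x y) (∧-comm (adj G v x) (adj G v y))

  lcAdj-irrefl : ∀ {n} (G : Graph n) v x → lcAdj G v x x ≡ false
  lcAdj-irrefl G v x with x ≟ x
  ... | yes _ = adj-irrefl G x
  ... | no ¬p = ⊥-elim (¬p refl)

infixl 8 _*_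
_*_ : ∀ {n} → Graph n → Fin n → Graph n
G * v = record
  { adj        = lcAdj G v
  ; adj-sym    = lcAdj-sym G v
  ; adj-irrefl = lcAdj-irrefl G v
  }

pivot : ∀ {n} → Graph n → Fin n → Fin n → Graph n
pivot G v w = G * v * w * v

infixl 7 _∖_
_∖_ : ∀ {n} → Graph (suc n) → Fin (suc n) → Graph n
G ∖ v = record
  { adj        = λ x y → adj G (punchIn v x) (punchIn v y)
  ; adj-sym    = λ x y → adj-sym G (punchIn v x) (punchIn v y)
  ; adj-irrefl = λ x → adj-irrefl G (punchIn v x)
  }

-- G / v : G \ v if v is isolated, otherwise (G ∧ vw) \ v for a neighbour w
-- of v (we take the least neighbour; primality does not depend on the choice).

_/_ : ∀ {n} → Graph (suc n) → Fin (suc n) → Graph n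
G / v with any? (λ w → T? (adj G v w))
... | yes (w , _) = pivot G v w ∖ v
... | no  _       = G ∖ v

degree : ∀ {n} → Graph n → Fin n → ℕ
degree {n} G v = length (filterᵇ (adj G v) (allFin n))

IsSplit : ∀ {n} → Graph n → (Fin n → Bool) → Set
IsSplit {n} G S =
  (Σ (Fin n) λ a₁ → Σ (Fin n) λ a₂ → a₁ ≢ a₂ × S a₁ ≡ true × S a₂ ≡ true) ×
  (Σ (Fin n) λ b₁ → Σ (Fin n) λ b₂ → b₁ ≢ b₂ × S b₁ ≡ false × S b₂ ≡ false) ×
  (Σ (Fin n → Bool) λ A′ → Σ (Fin n → Bool) λ B′ →
     (∀ x → A′ x ≡ true → S x ≡ true) ×
     (∀ y → B′ y ≡ true → S y ≡ false) ×
     (∀ x y → S x ≡ true → S y ≡ false → adj G x y ≡ (A′ x ∧ B′ y)))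

HasSplit : ∀ {n} → Graph n → Set
HasSplit {n} G = Σ (Fin n → Bool) λ S → IsSplit G S

Prime : ∀ {n} → Graph n → Set
Prime G = ¬ HasSplit G

NonEssential : ∀ {n} → Graph (suc n) → Fin (suc n) → Set
NonEssential G v =
  (Prime (G ∖ v) × Prime (G * v ∖ v)) ⊎
  (Prime (G ∖ v) × Prime (G / v)) ⊎
  (Prime (G * v ∖ v) × Prime (G / v))

Essential : ∀ {n} → Graph (suc n) → Fin (suc n) → Set
Essential G v = ¬ NonEssential G v

-- Deleting v leaves its neighbour w with at most one neighbour (the other
-- neighbour of w); pivoting on an edge vu and then deleting v does the same to
-- u, because after the pivot u has no neighbours outside N(v) ∪ {v}.  A vertex
-- with at most one neighbour q forms, together with q, one side of a split as
-- soon as four vertices remain.  So G ∖ v and G / v are both non-prime, and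
-- at most one of the three graphs in the definition can be prime.
module Submission where

open import Defs
open import Data.Nat using (ℕ; suc; _≤_; s≤s)
open import Data.Fin using (Fin; #_; punchIn; punchOut; _≟_)
open import Data.Fin.Properties using (any?; punchInᵢ≢i; punchIn-punchOut; punchIn-injective)
open import Data.Bool using (Bool; true; false; _∧_; _∨_; _xor_; not; T; T?)
open import Data.Bool.Properties using (∨-zeroʳ; ∧-identityʳ; ∧-conicalʳ; not-involutive; xor-identityʳ; xor-same; ¬-not; T-≡)
open import Data.List using (List; []; _∷_; length; filterᵇ; allFin)
open import Data.List.Membership.Propositional using (_∈_)
open import Data.List.Membership.Propositional.Properties using (∈-filter⁺; ∈-filter⁻; ∈-allFin)
open import Data.List.Relation.Unary.Any using (here; there)
open import Data.List.Relation.Unary.AllPairs using (_∷_)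
open import Data.List.Relation.Unary.All using ([]; _∷_)
open import Data.List.Relation.Unary.Unique.Propositional using (Unique)
import Data.List.Relation.Unary.Unique.Propositional.Properties as Unique
open import Data.Product using (_×_; _,_; proj₂; ∃-syntax)
open import Data.Sum using (_⊎_; inj₁; inj₂; [_,_])
open import Data.Empty using (⊥)
open import Function using (_∘_; Equivalence)
open import Relation.Nullary using (yes; no; does; contradiction)
open import Relation.Unary using (Decidable)
open import Relation.Binary.PropositionalEquality
  using (_≡_; _≢_; refl; sym; trans; cong; cong₂; ≢-sym; module ≡-Reasoning)

adj⇒≢ : ∀ {n} (G : Graph n) {x y} → adj G x y ≡ true → x ≢ y
adj⇒≢ G {x} e refl with trans (sym e) (adj-irrefl G x)
... | ()

*-adj-≢ : ∀ {n} (G : Graph n) v {x y} → x ≢ y →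
  adj (G * v) x y ≡ (adj G x y xor (adj G v x ∧ adj G v y))
*-adj-≢ G v {x} {y} x≢y with x ≟ y
... | yes x≡y = contradiction x≡y x≢y
... | no _ = refl

*-adj-centre : ∀ {n} (G : Graph n) v x → adj (G * v) v x ≡ adj G v x
*-adj-centre G v x with v ≟ x
... | yes _ = refl
... | no _ rewrite adj-irrefl G v = xor-identityʳ (adj G v x)

other-of-pair : ∀ {A : Set} {xs : List A} {u : A} → Unique xs → length xs ≡ 2 → u ∈ xs →
  ∃[ c ] c ≢ u × c ∈ xs × (∀ {y} → y ∈ xs → y ≡ u ⊎ y ≡ c)
other-of-pair {xs = a ∷ b ∷ []} ((a≢b ∷ []) ∷ _) refl (here refl) =
  b , ≢-sym a≢b , there (here refl) ,
  λ { (here e) → inj₁ e ; (there (here e)) → inj₂ e ; (there (there ())) }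
other-of-pair {xs = a ∷ b ∷ []} ((a≢b ∷ []) ∷ _) refl (there (here refl)) =
  a , a≢b , here refl ,
  λ { (here e) → inj₂ e ; (there (here e)) → inj₁ e ; (there (there ())) }
other-of-pair {xs = _ ∷ _ ∷ []} _ refl (there (there ()))

degree-2-other-neighbour : ∀ {n} (G : Graph n) {v u} → degree G v ≡ 2 → adj G v u ≡ true →
  ∃[ c ] c ≢ u × adj G v c ≡ true × (∀ y → y ≢ u → y ≢ c → adj G v y ≡ false)
degree-2-other-neighbour {n} G {v} d vu =
  let c , c≢u , c∈N , only = other-of-pair (Unique.filter⁺ P? (Unique.allFin⁺ n)) d (∈N⁺ vu)
  in c , c≢u , ∈N⁻ c∈N , λ y y≢u y≢c → ¬-not (λ vy → [ y≢u , y≢c ] (only (∈N⁺ vy)))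
  where
  P? : Decidable (T ∘ adj G v)
  P? = T? ∘ adj G v
  ∈N⁺ : ∀ {x} → adj G v x ≡ true → x ∈ filterᵇ (adj G v) (allFin n)
  ∈N⁺ vx = ∈-filter⁺ P? (∈-allFin _) (Equivalence.from T-≡ vx)
  ∈N⁻ : ∀ {x} → x ∈ filterᵇ (adj G v) (allFin n) → adj G v x ≡ true
  ∈N⁻ x∈N = Equivalence.to T-≡ (proj₂ (∈-filter⁻ P? {xs = allFin n} x∈N))

pairSet : ∀ {m} → Fin m → Fin m → Fin m → Bool
pairSet p q x = does (x ≟ p) ∨ does (x ≟ q)

module PairSet {m : ℕ} (p q : Fin m) where

  pairSet-left : pairSet p q p ≡ true
  pairSet-left with p ≟ p
  ... | yes _ = refl
  ... | no p≢p = contradiction refl p≢p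

  pairSet-right : pairSet p q q ≡ true
  pairSet-right with q ≟ q
  ... | yes _ = ∨-zeroʳ _
  ... | no q≢q = contradiction refl q≢q

  pairSet⁻ : ∀ {x} → pairSet p q x ≡ true → x ≡ p ⊎ x ≡ q
  pairSet⁻ {x} e with x ≟ p | x ≟ q
  ... | yes x≡p | _     = inj₁ x≡p
  ... | no _    | yes x≡q = inj₂ x≡q
  ... | no _    | no _  with () ← e

  ∉pairSet⁺ : ∀ {x} → x ≢ p → x ≢ q → pairSet p q x ≡ false
  ∉pairSet⁺ {x} x≢p x≢q = ¬-not ([ x≢p , x≢q ] ∘ pairSet⁻)

  ∉pairSet⁻ : ∀ {x} → pairSet p q x ≡ false → x ≢ p × x ≢ q
  ∉pairSet⁻ e = (λ { refl → no-member e pairSet-left }) , (λ { refl → no-member e pairSet-right })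
    where
    no-member : ∀ {b} → b ≡ false → b ≡ true → ⊥
    no-member refl ()

avoid-pair : ∀ {k} {p q : Fin (suc (suc k))} → p ≢ q → Fin k → Fin (suc (suc k))
avoid-pair {p = p} p≢q = punchIn p ∘ punchIn (punchOut p≢q)

avoid-pair-injective : ∀ {k} {p q : Fin (suc (suc k))} (p≢q : p ≢ q) {x y} →
  avoid-pair p≢q x ≡ avoid-pair p≢q y → x ≡ y
avoid-pair-injective {p = p} p≢q {x} {y} =
  punchIn-injective (punchOut p≢q) x y ∘ punchIn-injective p _ _

avoid-pair-≢ : ∀ {k} {p q : Fin (suc (suc k))} (p≢q : p ≢ q) x →
  avoid-pair p≢q x ≢ p × avoid-pair p≢q x ≢ q
avoid-pair-≢ {p = p} p≢q x =
  punchInᵢ≢i p _ ,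
  λ e → punchInᵢ≢i (punchOut p≢q) x
          (punchIn-injective p _ _ (trans e (sym (punchIn-punchOut p≢q))))

pendant-split : ∀ {m} (H : Graph m) → 4 ≤ m → {p q : Fin m} → p ≢ q →
  (∀ y → y ≢ p → y ≢ q → adj H p y ≡ false) → HasSplit H
pendant-split {suc (suc (suc (suc k)))} H (s≤s (s≤s (s≤s (s≤s _)))) {p} {q} p≢q p-pendant =
  S , (p , q , p≢q , pairSet-left , pairSet-right) ,
  (b (# 0) , b (# 1) , (λ e → 0≢1 (avoid-pair-injective p≢q e)) , outside (# 0) , outside (# 1)) ,
  A′ , B′ , A′⊆A , B′⊆B , adj-across
  where
  open PairSet p q
  S : Fin _ → Bool
  S = pairSet p q
  b : Fin (suc (suc k)) → Fin _
  b = avoid-pair p≢q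
  0≢1 : # 0 ≢ # 1
  0≢1 ()
  outside : ∀ x → S (b x) ≡ false
  outside x = let b≢p , b≢q = avoid-pair-≢ p≢q x in ∉pairSet⁺ b≢p b≢q
  A′ B′ : Fin _ → Bool
  A′ x = does (x ≟ q)
  B′ y = adj H q y ∧ not (S y)
  A′⊆A : ∀ x → A′ x ≡ true → S x ≡ true
  A′⊆A x e with x ≟ q | e
  ... | yes refl | _ = ∨-zeroʳ _
  B′⊆B : ∀ y → B′ y ≡ true → S y ≡ false
  B′⊆B y e = trans (sym (not-involutive (S y))) (cong not (∧-conicalʳ (adj H q y) _ e))
  adj-across : ∀ x y → S x ≡ true → S y ≡ false → adj H x y ≡ (A′ x ∧ B′ y)
  adj-across x y x∈A y∈B with pairSet⁻ {x} x∈A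
  ... | inj₁ refl with p ≟ q
  ...   | yes p≡q = contradiction p≡q p≢q
  ...   | no _    = let y≢p , y≢q = ∉pairSet⁻ y∈B in p-pendant y y≢p y≢q
  adj-across x y x∈A y∈B | inj₂ refl with q ≟ q
  ...   | no q≢q = contradiction refl q≢q
  ...   | yes _ rewrite y∈B = sym (∧-identityʳ (adj H q y))

∖-pendant-split : ∀ {m} (G : Graph (suc m)) → 4 ≤ m → {v P Q : Fin (suc m)} →
  v ≢ P → v ≢ Q → P ≢ Q → (∀ Y → Y ≢ v → Y ≢ P → Y ≢ Q → adj G P Y ≡ false) →
  HasSplit (G ∖ v)
∖-pendant-split G 4≤m {v} {P} {Q} v≢P v≢Q P≢Q P-pendant =
  pendant-split (G ∖ v) 4≤m p≢q p-pendant
  where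
  p q : Fin _
  p = punchOut v≢P
  q = punchOut v≢Q
  punchIn-≢ : ∀ {X} (v≢X : v ≢ X) {y} → y ≢ punchOut v≢X → punchIn v y ≢ X
  punchIn-≢ v≢X y≢x e = y≢x (punchIn-injective v _ _ (trans e (sym (punchIn-punchOut v≢X))))
  p≢q : p ≢ q
  p≢q e = P≢Q (begin
    P                ≡⟨ punchIn-punchOut v≢P ⟨
    punchIn v p      ≡⟨ cong (punchIn v) e ⟩
    punchIn v q      ≡⟨ punchIn-punchOut v≢Q ⟩
    Q                ∎)
    where open ≡-Reasoning
  p-pendant : ∀ y → y ≢ p → y ≢ q → adj (G ∖ v) p y ≡ false
  p-pendant y y≢p y≢q rewrite punchIn-punchOut v≢P =
    P-pendant (punchIn v y) (punchInᵢ≢i v y) (punchIn-≢ v≢P y≢p) (punchIn-≢ v≢Q y≢q)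

pivot-pendant : ∀ {n} (G : Graph n) {v u y} → adj G v u ≡ true → adj G v y ≡ false →
  y ≢ v → y ≢ u → adj (pivot G v u) u y ≡ false
pivot-pendant G {v} {u} {y} vu vy y≢v y≢u = begin
  adj (G₂ * v) u y                          ≡⟨ *-adj-≢ G₂ v (≢-sym y≢u) ⟩
  adj G₂ u y xor (adj G₂ v u ∧ adj G₂ v y)  ≡⟨ cong₂ _xor_ (*-adj-centre G₁ u y)
                                                     (cong₂ _∧_ G₂vu G₂vy) ⟩
  adj G₁ u y xor adj G₁ u y                 ≡⟨ xor-same (adj G₁ u y) ⟩
  false                                     ∎
  where
  open ≡-Reasoning
  G₁ G₂ : Graph _
  G₁ = G * v
  G₂ = G₁ * u
  G₁uv : adj G₁ u v ≡ true
  G₁uv = trans (adj-sym G₁ u v) (trans (*-adj-centre G v u) vu)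
  G₂vu : adj G₂ v u ≡ true
  G₂vu = trans (adj-sym G₂ v u) (trans (*-adj-centre G₁ u v) G₁uv)
  G₂vy : adj G₂ v y ≡ adj G₁ u y
  G₂vy = begin
    adj G₂ v y                                ≡⟨ *-adj-≢ G₁ u (≢-sym y≢v) ⟩
    adj G₁ v y xor (adj G₁ u v ∧ adj G₁ u y)  ≡⟨ cong₂ (λ a b → a xor (b ∧ adj G₁ u y))
                                                       (trans (*-adj-centre G v y) vy) G₁uv ⟩
    adj G₁ u y                                ∎

∖-split : ∀ {n} (G : Graph (suc n)) → 4 ≤ n → {v w : Fin (suc n)} →
  adj G v w ≡ true → degree G w ≡ 2 → HasSplit (G ∖ v)
∖-split G 4≤n {v} {w} vw dw =
  let b , b≢v , wb , w-only = degree-2-other-neighbour G dw (trans (adj-sym G w v) vw)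
  in ∖-pendant-split G 4≤n (adj⇒≢ G vw) (≢-sym b≢v) (adj⇒≢ G wb)
       (λ Y Y≢v _ Y≢b → w-only Y Y≢v Y≢b)

/-split : ∀ {n} (G : Graph (suc n)) → 4 ≤ n → {v w : Fin (suc n)} →
  adj G v w ≡ true → degree G v ≡ 2 → HasSplit (G / v)
/-split G 4≤n {v} {w} vw dv with any? (λ x → T? (adj G v x))
... | no isolated = contradiction (w , Equivalence.from T-≡ vw) isolated
... | yes (u , T-vu) =
  let vu = Equivalence.to T-≡ T-vu
      c , c≢u , vc , v-only = degree-2-other-neighbour G dv vu
  in ∖-pendant-split (pivot G v u) 4≤n (adj⇒≢ G vu) (adj⇒≢ G vc) (≢-sym c≢u)
       (λ Y Y≢v Y≢u Y≢c → pivot-pendant G vu (v-only Y Y≢u Y≢c) Y≢v Y≢u)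

splits⇒Essential : ∀ {n} (G : Graph (suc n)) {v} →
  HasSplit (G ∖ v) → HasSplit (G / v) → Essential G v
splits⇒Essential G split∖ split/ (inj₁ (prime∖ , _))        = prime∖ split∖
splits⇒Essential G split∖ split/ (inj₂ (inj₁ (prime∖ , _))) = prime∖ split∖
splits⇒Essential G split∖ split/ (inj₂ (inj₂ (_ , prime/))) = prime/ split/

lemma6p3 : ∀ (n : ℕ) (G : Graph (suc n)) (v w : Fin (suc n)) →
    5 ≤ suc n → adj G v w ≡ true → degree G v ≡ 2 → degree G w ≡ 2 →
    Essential G v × Essential G w
lemma6p3 n G v w (s≤s 4≤n) vw dv dw =
  splits⇒Essential G (∖-split G 4≤n vw dw) (/-split G 4≤n vw dv) ,
  splits⇒Essential G (∖-split G 4≤n wv dv) (/-split G 4≤n wv dw)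
  where
  wv : adj G w v ≡ true
  wv = trans (adj-sym G w v) vw
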